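{- Let $x,a,b,c$ be positive integers such that $\frac{a}{cb^x}>1$ is in lowest terms and $\frac{a}{cb^x}=I(x,n)$ for some positive integer $n$. Suppose $d=\prod_{i=1}^{s}p_i^{k_i}$ ($p_i$ distinct primes, $k_i\ge1$) is a positive integer such that $d^x$ divides $cb^x$ and $I(x,p_i d)>\frac{a}{cb^x}$ for all $1\le i\le s$. Then $\frac{d^x}{\sigma_x(d)}\cdot\frac{a}{cb^x}$ is an $x^{\text{th}}$ abundancy index, i.e. it equals $I(x,m)$ for some positive integer $m$.
   Context: For positive integers $x,n$, $\sigma_x(n)=\sum_{d\mid n} d^x$ and the $x^{\text{th}}$ abundancy index of $n$ is $I(x,n)=\sigma_x(n)/n^x$; a rational is an $x^{\text{th}}$ abundancy index if it equals $I(x,m)$ for some positive integer $m$. -}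

module Defs where

open import Data.Nat using (ℕ; zero; suc; _*_; _^_)
open import Data.Nat.ListAction using (sum; product)
open import Data.Nat.Divisibility using (_∣?_)
open import Data.List using (List; map; filter; applyUpTo)
open import Data.Integer using (+_)
open import Data.Rational using (ℚ; _/_; 0ℚ)

divisors : ℕ → List ℕ
divisors n = filter (_∣? n) (applyUpTo suc n)

σ : ℕ → ℕ → ℕ
σ x n = sum (map (λ d → d ^ x) (divisors n))

-- the rational p/q; only ever applied with q ≥ 1 (returns 0 for q = 0)
infix 5 _÷_
_÷_ : ℕ → ℕ → ℚ
p ÷ zero    = 0ℚ
p ÷ (suc q) = (+ p) / suc q

I : ℕ → ℕ → ℚ
I x n = σ x n ÷ (n ^ x)

open import Data.Product using (_×_; _,_; proj₁; proj₂)
primePowProd : List (ℕ × ℕ) → ℕ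
primePowProd ps = product (map (λ pk → proj₁ pk ^ proj₂ pk) ps)

module Submission where

-- Write B = c·bˣ and d = ∏ pᵢ^kᵢ.  From a/B = I(x,n) we get a·nˣ = σₓ(n)·B, and
-- since gcd(a,B) = 1 this gives B ∣ nˣ; hence dˣ ∣ nˣ, so d ∣ n, say n = d·m.
-- A prime q dividing both d and m is one of the pᵢ (it divides the prime-power
-- product d), and then pᵢ·d ∣ n.  The abundancy index is monotone along
-- divisibility, so I(x,pᵢd) ≤ I(x,n) = a/B, contradicting I(x,pᵢd) > a/B.
-- Therefore gcd(d,m) = 1, σₓ(d·m) = σₓ(d)·σₓ(m), and
--     (dˣ/σₓ(d))·(a/B) = (dˣ/σₓ(d))·I(x,d·m) = σₓ(m)/mˣ = I(x,m).

open import Defs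
open import Data.Nat using (ℕ; zero; suc; _+_; _*_; _^_; _≤_; s≤s; z≤n; NonZero; >-nonZero; >-nonZero⁻¹; nonTrivial⇒≢1)
open import Data.Nat.Properties
open import Data.Nat.Divisibility
open import Data.Nat.Primality using (Prime; euclidsLemma; prime⇒irreducible; prime⇒nonTrivial; prime⇒nonZero)
open import Data.Nat.Primality.Factorisation using (factorise)
open import Data.Nat.Coprimality using (Coprime; coprime-divisor) renaming (sym to coprime-sym)
open import Data.Nat.GCD using (gcd; gcd[m,n]∣m; gcd[m,n]∣n; gcd-greatest)
open import Data.Nat.ListAction using (sum; product)
open import Data.Nat.ListAction.Properties using (sum-++)
open import Data.Nat.Solver using (module +-*-Solver)
import Data.Integer as ℤ
import Data.Integer.Properties as ℤP
open import Data.Rational using (1ℚ; toℚᵘ) renaming (_<_ to _<ℚ_; _≤_ to _≤ℚ_; _*_ to _*ℚ_)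
import Data.Rational.Properties as ℚP
open import Data.Rational.Unnormalised as ℚᵘ using (mkℚᵘ; *≡*; *≤*) renaming (_≃_ to _≃ᵘ_)
import Data.Rational.Unnormalised.Properties as ℚᵘP
open import Data.List using (List; []; _∷_; map; applyUpTo; cartesianProductWith; _++_)
open import Data.List.Properties using (map-++)
open import Data.List.Membership.Propositional using (_∈_)
open import Data.List.Membership.Propositional.Properties
  using (∈-filter⁺; ∈-filter⁻; ∈-applyUpTo⁺; ∈-map⁻; ∈-∃++; ∈-++⁺ˡ; ∈-++⁺ʳ; ∈-++⁻;
         ∈-cartesianProductWith⁺; ∈-cartesianProductWith⁻)
open import Data.List.Relation.Binary.Subset.Propositional using (_⊆_)
open import Data.List.Relation.Unary.Any using (Any; here; there)
open import Data.List.Relation.Unary.All as All using (All; []; _∷_)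
open import Data.List.Relation.Unary.AllPairs using ([]; _∷_)
open import Data.List.Relation.Unary.Unique.Propositional using (Unique)
import Data.List.Relation.Unary.Unique.Propositional.Properties as Unique
open import Data.Product using (Σ; ∃; ∃₂; _×_; _,_; proj₁; proj₂)
open import Data.Sum using (inj₁; inj₂)
open import Data.Empty using (⊥; ⊥-elim)
open import Function using (_∘_; id)
open import Relation.Nullary using (¬_)
open import Relation.Binary.PropositionalEquality

open +-*-Solver using (solve; _:+_; _:*_; _:=_)

∣-pos : ∀ {t n} → 1 ≤ n → t ∣ n → 1 ≤ t
∣-pos {zero}  n≥1 0∣n = ⊥-elim (<-irrefl refl (subst (1 ≤_) (0∣⇒≡0 0∣n) n≥1))
∣-pos {suc t} _   _   = s≤s z≤n

^-pos : ∀ k {m} → 1 ≤ m → 1 ≤ m ^ k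
^-pos k {m} m≥1 = m^n>0 m {{>-nonZero m≥1}} k

*-pos : ∀ {m n} → 1 ≤ m → 1 ≤ n → 1 ≤ m * n
*-pos = *-mono-≤

toℚᵘ-÷ : ∀ p q → toℚᵘ (p ÷ suc q) ≃ᵘ mkℚᵘ (ℤ.+ p) q
toℚᵘ-÷ p q = ℚP.toℚᵘ-fromℚᵘ (mkℚᵘ (ℤ.+ p) q)

÷-≡⇒cross : ∀ {p p'} q q' → 1 ≤ q → 1 ≤ q' → p ÷ q ≡ p' ÷ q' → p * q' ≡ p' * q
÷-≡⇒cross {p} {p'} (suc q) (suc q') _ _ eq
  with ℚP.fromℚᵘ-injective {mkℚᵘ (ℤ.+ p) q} {mkℚᵘ (ℤ.+ p') q'} eq
... | *≡* cross = ℤP.+-injective (trans (ℤP.pos-* p (suc q')) (trans cross (sym (ℤP.pos-* p' (suc q)))))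

cross⇒÷-≡ : ∀ {p p'} q q' → 1 ≤ q → 1 ≤ q' → p * q' ≡ p' * q → p ÷ q ≡ p' ÷ q'
cross⇒÷-≡ {p} {p'} (suc q) (suc q') _ _ eq = ℚP.fromℚᵘ-cong {mkℚᵘ (ℤ.+ p) q} {mkℚᵘ (ℤ.+ p') q'}
  (*≡* (trans (sym (ℤP.pos-* p (suc q'))) (trans (cong ℤ.+_ eq) (ℤP.pos-* p' (suc q)))))

cross-≤⇒÷-≤ : ∀ {p p'} q q' → 1 ≤ q → 1 ≤ q' → p * q' ≤ p' * q → p ÷ q ≤ℚ p' ÷ q'
cross-≤⇒÷-≤ {p} {p'} (suc q) (suc q') _ _ le = ℚP.toℚᵘ-cancel-≤
  (ℚᵘP.≤-respˡ-≃ (ℚᵘP.≃-sym (toℚᵘ-÷ p q)) (ℚᵘP.≤-respʳ-≃ (ℚᵘP.≃-sym (toℚᵘ-÷ p' q'))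
    (*≤* (subst₂ ℤ._≤_ (ℤP.pos-* p (suc q')) (ℤP.pos-* p' (suc q)) (ℤ.+≤+ le)))))

÷-*-÷ : ∀ p q p' q' → 1 ≤ q → 1 ≤ q' → (p ÷ q) *ℚ (p' ÷ q') ≡ (p * p') ÷ (q * q')
÷-*-÷ p (suc q) p' (suc q') _ _ = ℚP.toℚᵘ-injective (begin
  toℚᵘ ((p ÷ suc q) *ℚ (p' ÷ suc q'))     ≈⟨ ℚP.toℚᵘ-homo-* (p ÷ suc q) (p' ÷ suc q') ⟩
  toℚᵘ (p ÷ suc q) ℚᵘ.* toℚᵘ (p' ÷ suc q') ≈⟨ ℚᵘP.*-cong (toℚᵘ-÷ p q) (toℚᵘ-÷ p' q') ⟩
  mkℚᵘ (ℤ.+ p) q ℚᵘ.* mkℚᵘ (ℤ.+ p') q'     ≈⟨ *≡* (cong₂ ℤ._*_ (sym (ℤP.pos-* p p')) (sym (ℤP.pos-* (suc q) (suc q')))) ⟩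
  mkℚᵘ (ℤ.+ (p * p')) (q' + q * suc q')    ≈⟨ ℚᵘP.≃-sym (toℚᵘ-÷ (p * p') (q' + q * suc q')) ⟩
  toℚᵘ ((p * p') ÷ (suc q * suc q'))       ∎)
  where open ℚᵘP.≃-Reasoning

∈-divisors⁺ : ∀ n {t} → 1 ≤ n → t ∣ n → t ∈ divisors n
∈-divisors⁺ (suc n) {zero}  _ 0∣n = ⊥-elim (1+n≢0 (0∣⇒≡0 0∣n))
∈-divisors⁺ (suc n) {suc t} _ t∣n = ∈-filter⁺ (_∣? suc n) (∈-applyUpTo⁺ suc (∣⇒≤ t∣n)) t∣n

∈-divisors⁻ : ∀ n {t} → t ∈ divisors n → t ∣ n
∈-divisors⁻ n t∈ = proj₂ (∈-filter⁻ (_∣? n) {xs = applyUpTo suc n} t∈)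

divisors-unique : ∀ n → Unique (divisors n)
divisors-unique n = Unique.filter⁺ (_∣? n)
  (Unique.applyUpTo⁺₁ suc n (λ i<j _ eq → <⇒≢ i<j (suc-injective eq)))

sum-map-++ : ∀ (f : ℕ → ℕ) xs ys → sum (map f (xs ++ ys)) ≡ sum (map f xs) + sum (map f ys)
sum-map-++ f xs ys = trans (cong sum (map-++ f xs ys)) (sum-++ (map f xs) (map f ys))

∈-remove : ∀ {z y : ℕ} us vs → z ∈ us ++ y ∷ vs → y ≢ z → z ∈ us ++ vs
∈-remove us vs z∈ y≢z with ∈-++⁻ us z∈
... | inj₁ z∈us           = ∈-++⁺ˡ z∈us
... | inj₂ (here refl)    = ⊥-elim (y≢z refl)
... | inj₂ (there z∈vs)   = ∈-++⁺ʳ us z∈vs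

sum-mono-⊆ : ∀ (f : ℕ → ℕ) {L M} → Unique L → L ⊆ M → sum (map f L) ≤ sum (map f M)
sum-mono-⊆ f {[]}    _            _   = z≤n
sum-mono-⊆ f {y ∷ L} (y∉L ∷ uniq) L⊆M with ∈-∃++ (L⊆M (here refl))
... | us , vs , refl = begin
  f y + sum (map f L)                     ≤⟨ +-monoʳ-≤ (f y) (sum-mono-⊆ f uniq L⊆us++vs) ⟩
  f y + sum (map f (us ++ vs))            ≡⟨ cong (f y +_) (sum-map-++ f us vs) ⟩
  f y + (sum (map f us) + sum (map f vs)) ≡⟨ solve 3 (λ a b c → a :+ (b :+ c) := b :+ (a :+ c)) refl (f y) (sum (map f us)) (sum (map f vs)) ⟩
  sum (map f us) + (f y + sum (map f vs)) ≡⟨ sym (sum-map-++ f us (y ∷ vs)) ⟩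
  sum (map f (us ++ y ∷ vs))              ∎
  where
  open ≤-Reasoning
  L⊆us++vs : L ⊆ us ++ vs
  L⊆us++vs z∈L = ∈-remove us vs (L⊆M (there z∈L)) (All.lookup y∉L z∈L)

powerSum : ℕ → List ℕ → ℕ
powerSum x L = sum (map (_^ x) L)

*-distrib-^ : ∀ m n k → (m * n) ^ k ≡ m ^ k * n ^ k
*-distrib-^ m n zero    = refl
*-distrib-^ m n (suc k) = begin
  m * n * (m * n) ^ k     ≡⟨ cong (m * n *_) (*-distrib-^ m n k) ⟩
  m * n * (m ^ k * n ^ k) ≡⟨ solve 4 (λ m n p q → m :* n :* (p :* q) := m :* p :* (n :* q)) refl m n (m ^ k) (n ^ k) ⟩
  m * m ^ k * (n * n ^ k) ∎
  where open ≡-Reasoning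

powerSum-scale : ∀ x k L → powerSum x (map (k *_) L) ≡ k ^ x * powerSum x L
powerSum-scale x k []      = sym (*-zeroʳ (k ^ x))
powerSum-scale x k (t ∷ L) = begin
  (k * t) ^ x + powerSum x (map (k *_) L) ≡⟨ cong₂ _+_ (*-distrib-^ k t x) (powerSum-scale x k L) ⟩
  k ^ x * t ^ x + k ^ x * powerSum x L    ≡⟨ sym (*-distribˡ-+ (k ^ x) _ _) ⟩
  k ^ x * (t ^ x + powerSum x L)          ∎
  where open ≡-Reasoning

powerSum-product : ∀ x L M → powerSum x (cartesianProductWith _*_ L M) ≡ powerSum x L * powerSum x M
powerSum-product x []      M = refl
powerSum-product x (t ∷ L) M = begin
  powerSum x (map (t *_) M ++ cartesianProductWith _*_ L M)
    ≡⟨ sum-map-++ (_^ x) (map (t *_) M) _ ⟩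
  powerSum x (map (t *_) M) + powerSum x (cartesianProductWith _*_ L M)
    ≡⟨ cong₂ _+_ (powerSum-scale x t M) (powerSum-product x L M) ⟩
  t ^ x * powerSum x M + powerSum x L * powerSum x M
    ≡⟨ sym (*-distribʳ-+ (powerSum x M) (t ^ x) _) ⟩
  (t ^ x + powerSum x L) * powerSum x M ∎
  where open ≡-Reasoning

σ-pos : ∀ x {n} → 1 ≤ n → 1 ≤ σ x n
σ-pos x {n} n≥1 = subst (_≤ σ x n) (cong (_+ 0) (^-zeroˡ x))
  (sum-mono-⊆ (_^ x) ([] ∷ []) λ { (here refl) → ∈-divisors⁺ n n≥1 (1∣ n) })

-- For e ∣ n, i.e. n = k·e: multiplying the divisors of e by k gives distinct
-- divisors of n, so kˣ·σₓ(e) ≤ σₓ(n), i.e. σₓ(e)·nˣ ≤ σₓ(n)·eˣ.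
σ-cross-mono : ∀ x {e n} → 1 ≤ n → e ∣ n → σ x e * n ^ x ≤ σ x n * e ^ x
σ-cross-mono x {e} n≥1 (divides k refl) = begin
  σ x e * (k * e) ^ x                          ≡⟨ cong (σ x e *_) (*-distrib-^ k e x) ⟩
  σ x e * (k ^ x * e ^ x)                      ≡⟨ solve 3 (λ s a b → s :* (a :* b) := a :* s :* b) refl (σ x e) (k ^ x) (e ^ x) ⟩
  k ^ x * σ x e * e ^ x                        ≡⟨ cong (_* e ^ x) (sym (powerSum-scale x k (divisors e))) ⟩
  powerSum x (map (k *_) (divisors e)) * e ^ x ≤⟨ *-monoˡ-≤ (e ^ x) (sum-mono-⊆ (_^ x) scaled-unique scaled⊆) ⟩
  σ x (k * e) * e ^ x                          ∎
  where
  open ≤-Reasoning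
  instance
    k≢0 : NonZero k
    k≢0 = >-nonZero (∣-pos n≥1 (m∣m*n e))
  scaled-unique : Unique (map (k *_) (divisors e))
  scaled-unique = Unique.map⁺ (*-cancelˡ-≡ _ _ k) (divisors-unique e)
  scaled⊆ : map (k *_) (divisors e) ⊆ divisors (k * e)
  scaled⊆ z∈ with ∈-map⁻ (k *_) z∈
  ... | t , t∈ , refl = ∈-divisors⁺ (k * e) n≥1 (*-monoʳ-∣ k (∈-divisors⁻ e t∈))

abundancy-mono : ∀ x {e n} → 1 ≤ n → e ∣ n → I x e ≤ℚ I x n
abundancy-mono x {e} {n} n≥1 e∣n =
  cross-≤⇒÷-≤ (e ^ x) (n ^ x) (^-pos x (∣-pos n≥1 e∣n)) (^-pos x n≥1) (σ-cross-mono x n≥1 e∣n)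

gcd-cofactors : ∀ u {v} → 1 ≤ v →
  ∃₂ λ u' v' → u ≡ u' * gcd u v × v ≡ v' * gcd u v × Coprime u' v'
gcd-cofactors u {v} v≥1 with gcd[m,n]∣m u v | gcd[m,n]∣n u v
... | divides u' u≡u'g | divides v' v≡v'g = u' , v' , u≡u'g , v≡v'g , cofactors-coprime
  where
  g : ℕ
  g = gcd u v
  instance
    g≢0 : NonZero g
    g≢0 = >-nonZero (∣-pos v≥1 (gcd[m,n]∣n u v))
  cofactors-coprime : Coprime u' v'
  cofactors-coprime {c} (c∣u' , c∣v') = ∣1⇒≡1 (*-cancelʳ-∣ g (subst (c * g ∣_) (sym (*-identityˡ g))
    (gcd-greatest (subst (c * g ∣_) (sym u≡u'g) (*-monoˡ-∣ g c∣u'))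
                  (subst (c * g ∣_) (sym v≡v'g) (*-monoˡ-∣ g c∣v')))))

divisor-split : ∀ {d m v} → 1 ≤ d → v ∣ d * m → ∃₂ λ t w → t ∣ d × w ∣ m × v ≡ t * w
divisor-split {d} {m} {v} d≥1 v∣dm with gcd-cofactors v d≥1
... | w , d' , v≡wg , d≡d'g , w⊥d' = g , w , gcd[m,n]∣n v d , w∣m , trans v≡wg (*-comm w g)
  where
  g : ℕ
  g = gcd v d
  instance
    g≢0 : NonZero g
    g≢0 = >-nonZero (∣-pos d≥1 (gcd[m,n]∣n v d))
  dm≡d'mg : d * m ≡ d' * m * g
  dm≡d'mg = trans (cong (_* m) d≡d'g) (solve 3 (λ a b c → a :* b :* c := a :* c :* b) refl d' g m)
  w∣m : w ∣ m
  w∣m = coprime-divisor w⊥d' (*-cancelʳ-∣ g (subst₂ _∣_ v≡wg dm≡d'mg v∣dm))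

coprime-factor-unique : ∀ {d m t t' u u'} → Coprime d m →
  t ∣ d → t' ∣ d → u ∣ m → u' ∣ m → t * u ≡ t' * u' → t ≡ t'
coprime-factor-unique {d} {m} d⊥m t∣d t'∣d u∣m u'∣m eq =
  ∣-antisym (divides-other t∣d u'∣m eq) (divides-other t'∣d u∣m (sym eq))
  where
  divides-other : ∀ {t t' u u'} → t ∣ d → u' ∣ m → t * u ≡ t' * u' → t ∣ t'
  divides-other {t} {t'} {u} {u'} t∣d u'∣m eq =
    coprime-divisor (λ (c∣t , c∣u') → d⊥m (∣-trans c∣t t∣d , ∣-trans c∣u' u'∣m))
      (divides u (trans (*-comm u' t') (trans (sym eq) (*-comm t u))))

products-unique : ∀ {d m L} → 1 ≤ d → Coprime d m → Unique L → L ⊆ divisors d →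
  Unique (cartesianProductWith _*_ L (divisors m))
products-unique {L = []}    _   _   _            _   = []
products-unique {d} {m} {t ∷ L} d≥1 d⊥m (t∉L ∷ uniq) L⊆ =
  Unique.++⁺ (Unique.map⁺ (*-cancelˡ-≡ _ _ t) (divisors-unique m))
             (products-unique d≥1 d⊥m uniq (L⊆ ∘ there)) disjoint
  where
  instance
    t≢0 : NonZero t
    t≢0 = >-nonZero (∣-pos d≥1 (∈-divisors⁻ d (L⊆ (here refl))))
  disjoint : ∀ {v} → ¬ (v ∈ map (t *_) (divisors m) × v ∈ cartesianProductWith _*_ L (divisors m))
  disjoint (v∈ , v∈') with ∈-map⁻ (t *_) v∈ | ∈-cartesianProductWith⁻ _*_ L (divisors m) v∈'
  ... | u , u∈ , refl | t' , u' , t'∈ , u'∈ , eq =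
    All.lookup t∉L t'∈ (coprime-factor-unique d⊥m (∈-divisors⁻ d (L⊆ (here refl))) (∈-divisors⁻ d (L⊆ (there t'∈)))
      (∈-divisors⁻ m u∈) (∈-divisors⁻ m u'∈) eq)

-- σₓ is multiplicative: the divisors of d·m are exactly the products of a divisor
-- of d with a divisor of m, each arising once.
σ-multiplicative : ∀ x {d m} → 1 ≤ d → 1 ≤ m → Coprime d m → σ x (d * m) ≡ σ x d * σ x m
σ-multiplicative x {d} {m} d≥1 m≥1 d⊥m = begin
  σ x (d * m)         ≡⟨ ≤-antisym (sum-mono-⊆ (_^ x) (divisors-unique (d * m)) divisors⊆products)
                                   (sum-mono-⊆ (_^ x) (products-unique d≥1 d⊥m (divisors-unique d) id) products⊆divisors) ⟩
  powerSum x products ≡⟨ powerSum-product x (divisors d) (divisors m) ⟩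
  σ x d * σ x m       ∎
  where
  open ≡-Reasoning
  products : List ℕ
  products = cartesianProductWith _*_ (divisors d) (divisors m)
  products⊆divisors : products ⊆ divisors (d * m)
  products⊆divisors v∈ with ∈-cartesianProductWith⁻ _*_ (divisors d) (divisors m) v∈
  ... | t , u , t∈ , u∈ , refl = ∈-divisors⁺ (d * m) (*-pos d≥1 m≥1) (*-pres-∣ (∈-divisors⁻ d t∈) (∈-divisors⁻ m u∈))
  divisors⊆products : divisors (d * m) ⊆ products
  divisors⊆products v∈ with divisor-split d≥1 (∈-divisors⁻ (d * m) v∈)
  ... | t , w , t∣d , w∣m , refl = ∈-cartesianProductWith⁺ _*_ (∈-divisors⁺ d d≥1 t∣d) (∈-divisors⁺ m m≥1 w∣m)

abundancy-cofactor : ∀ x {d m} → 1 ≤ d → 1 ≤ m → Coprime d m →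
  (d ^ x ÷ σ x d) *ℚ I x (d * m) ≡ I x m
abundancy-cofactor x {d} {m} d≥1 m≥1 d⊥m = begin
  (d ^ x ÷ σ x d) *ℚ (σ x (d * m) ÷ (d * m) ^ x)
    ≡⟨ ÷-*-÷ (d ^ x) (σ x d) (σ x (d * m)) ((d * m) ^ x) (σ-pos x d≥1) (^-pos x (*-pos d≥1 m≥1)) ⟩
  (d ^ x * σ x (d * m)) ÷ (σ x d * (d * m) ^ x)
    ≡⟨ cross⇒÷-≡ (σ x d * (d * m) ^ x) (m ^ x) (*-pos (σ-pos x d≥1) (^-pos x (*-pos d≥1 m≥1))) (^-pos x m≥1) cross ⟩
  σ x m ÷ m ^ x ∎
  where
  open ≡-Reasoning
  cross : d ^ x * σ x (d * m) * m ^ x ≡ σ x m * (σ x d * (d * m) ^ x)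
  cross = begin
    d ^ x * σ x (d * m) * m ^ x       ≡⟨ cong (λ s → d ^ x * s * m ^ x) (σ-multiplicative x d≥1 m≥1 d⊥m) ⟩
    d ^ x * (σ x d * σ x m) * m ^ x   ≡⟨ solve 4 (λ D M s t → D :* (s :* t) :* M := t :* (s :* (D :* M))) refl (d ^ x) (m ^ x) (σ x d) (σ x m) ⟩
    σ x m * (σ x d * (d ^ x * m ^ x)) ≡⟨ cong (λ p → σ x m * (σ x d * p)) (sym (*-distrib-^ d m x)) ⟩
    σ x m * (σ x d * (d * m) ^ x)     ∎

coprime-∣-^ : ∀ {a b} → Coprime a b → ∀ k → a ∣ b ^ k → a ≡ 1
coprime-∣-^ a⊥b zero    a∣1    = ∣1⇒≡1 a∣1
coprime-∣-^ a⊥b (suc k) a∣b^1+k = coprime-∣-^ a⊥b k (coprime-divisor a⊥b a∣b^1+k)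

-- dˣ ∣ nˣ with x ≥ 1 forces d ∣ n: writing d = d'g, n = n'g with g = gcd(n,d),
-- d'ˣ ∣ n'ˣ and gcd(d',n') = 1 give d' = 1.
^-cancel-∣ : ∀ {d n} x → 1 ≤ x → 1 ≤ d → d ^ x ∣ n ^ x → d ∣ n
^-cancel-∣ {d} {n} x@(suc x-1) _ d≥1 dˣ∣nˣ with gcd-cofactors n d≥1
... | n' , d' , n≡n'g , d≡d'g , n'⊥d' =
  subst (_∣ n) (sym (trans d≡d'g (trans (cong (_* g) d'≡1) (*-identityˡ g)))) (gcd[m,n]∣m n d)
  where
  g : ℕ
  g = gcd n d
  instance
    gˣ≢0 : NonZero (g ^ x)
    gˣ≢0 = >-nonZero (^-pos x (∣-pos d≥1 (gcd[m,n]∣n n d)))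
  d'ˣ∣n'ˣ : d' ^ x ∣ n' ^ x
  d'ˣ∣n'ˣ = *-cancelʳ-∣ (g ^ x) (subst₂ _∣_
    (trans (cong (_^ x) d≡d'g) (*-distrib-^ d' g x)) (trans (cong (_^ x) n≡n'g) (*-distrib-^ n' g x)) dˣ∣nˣ)
  d'≡1 : d' ≡ 1
  d'≡1 = coprime-∣-^ (coprime-sym n'⊥d') x (∣-trans (m∣m*n (d' ^ x-1)) d'ˣ∣n'ˣ)

¬prime[1] : ¬ Prime 1
¬prime[1] 1-prime = nonTrivial⇒≢1 {{prime⇒nonTrivial 1-prime}} refl

prime-∣-^ : ∀ {q p} → Prime q → Prime p → ∀ k → q ∣ p ^ k → q ≡ p
prime-∣-^ q-prime p-prime zero    q∣1 = ⊥-elim (¬prime[1] (subst Prime (∣1⇒≡1 q∣1) q-prime))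
prime-∣-^ {p = p} q-prime p-prime (suc k) q∣p^1+k with euclidsLemma p (p ^ k) q-prime q∣p^1+k
... | inj₂ q∣p^k = prime-∣-^ q-prime p-prime k q∣p^k
... | inj₁ q∣p with prime⇒irreducible p-prime q∣p
...   | inj₁ refl = ⊥-elim (¬prime[1] q-prime)
...   | inj₂ q≡p  = q≡p

prime-∣-primePowProd : ∀ {q} ps → Prime q → All (Prime ∘ proj₁) ps →
  q ∣ primePowProd ps → Any ((q ≡_) ∘ proj₁) ps
prime-∣-primePowProd []             q-prime []               q∣1 = ⊥-elim (¬prime[1] (subst Prime (∣1⇒≡1 q∣1) q-prime))
prime-∣-primePowProd ((p , k) ∷ ps) q-prime (p-prime ∷ primes) q∣prod
  with euclidsLemma (p ^ k) (primePowProd ps) q-prime q∣prod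
... | inj₁ q∣p^k  = here (prime-∣-^ q-prime p-prime k q∣p^k)
... | inj₂ q∣rest = there (prime-∣-primePowProd ps q-prime primes q∣rest)

primePowProd-pos : ∀ ps → All (Prime ∘ proj₁) ps → 1 ≤ primePowProd ps
primePowProd-pos []             []                 = s≤s z≤n
primePowProd-pos ((p , k) ∷ ps) (p-prime ∷ primes) =
  *-pos (^-pos k (>-nonZero⁻¹ p {{prime⇒nonZero p-prime}})) (primePowProd-pos ps primes)

prime-divisor : ∀ e → 2 ≤ e → ∃ λ q → Prime q × q ∣ e
prime-divisor e@(suc _) 2≤e with factorise e
... | record { factors = [] ; isFactorisation = e≡1 } = ⊥-elim (<⇒≢ 2≤e (sym e≡1))
... | record { factors = q ∷ qs ; isFactorisation = e≡∏ ; factorsPrime = q-prime ∷ _ } =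
  q , q-prime , subst (q ∣_) (sym e≡∏) (m∣m*n (product qs))

no-common-prime⇒coprime : ∀ {d m} → 1 ≤ d → (∀ {q} → Prime q → q ∣ d → q ∣ m → ⊥) → Coprime d m
no-common-prime⇒coprime d≥1 none {zero}            (0∣d , _)   = ⊥-elim (<-irrefl refl (∣-pos d≥1 0∣d))
no-common-prime⇒coprime d≥1 none {suc zero}        _           = refl
no-common-prime⇒coprime d≥1 none {e@(suc (suc _))} (e∣d , e∣m) with prime-divisor e (s≤s (s≤s z≤n))
... | q , q-prime , q∣e = ⊥-elim (none q-prime (∣-trans q∣e e∣d) (∣-trans q∣e e∣m))

mainTheorem4 : (x a b c : ℕ) → 1 ≤ x → 1 ≤ a → 1 ≤ b → 1 ≤ c →
  Coprime a (c * b ^ x) →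
  1ℚ <ℚ (a ÷ (c * b ^ x)) →
  Σ ℕ (λ n → 1 ≤ n × a ÷ (c * b ^ x) ≡ I x n) →
  (ps : List (ℕ × ℕ)) →
  All (λ pk → Prime (proj₁ pk) × 1 ≤ proj₂ pk) ps →
  Unique (map proj₁ ps) →
  (primePowProd ps) ^ x ∣ c * b ^ x →
  All (λ pk → (a ÷ (c * b ^ x)) <ℚ I x (proj₁ pk * primePowProd ps)) ps →
  Σ ℕ (λ m → 1 ≤ m ×
    (((primePowProd ps) ^ x) ÷ (σ x (primePowProd ps))) *ℚ (a ÷ (c * b ^ x)) ≡ I x m)
mainTheorem4 x a b c x≥1 _ b≥1 c≥1 a⊥B _ (n , n≥1 , a/B≡In) ps prime-powers _ dˣ∣B below =
  m , m≥1 , (begin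
    (d ^ x ÷ σ x d) *ℚ (a ÷ B)       ≡⟨ cong ((d ^ x ÷ σ x d) *ℚ_) (trans a/B≡In (cong (I x) n≡dm)) ⟩
    (d ^ x ÷ σ x d) *ℚ I x (d * m)   ≡⟨ abundancy-cofactor x d≥1 m≥1 d⊥m ⟩
    I x m                             ∎)
  where
  open ≡-Reasoning
  B d : ℕ
  B = c * b ^ x
  d = primePowProd ps
  primes : All (Prime ∘ proj₁) ps
  primes = All.map proj₁ prime-powers
  d≥1 : 1 ≤ d
  d≥1 = primePowProd-pos ps primes
  -- a·nˣ = σₓ(n)·B and gcd(a,B) = 1 give B ∣ nˣ, hence dˣ ∣ nˣ and d ∣ n
  B∣nˣ : B ∣ n ^ x
  B∣nˣ = coprime-divisor (coprime-sym a⊥B)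
    (divides (σ x n) (÷-≡⇒cross B (n ^ x) (*-pos c≥1 (^-pos x b≥1)) (^-pos x n≥1) a/B≡In))
  d∣n : d ∣ n
  d∣n = ^-cancel-∣ x x≥1 d≥1 (∣-trans dˣ∣B B∣nˣ)
  m : ℕ
  m = quotient d∣n
  n≡dm : n ≡ d * m
  n≡dm = m∣n⇒n≡m*quotient d∣n
  m≥1 : 1 ≤ m
  m≥1 = ∣-pos n≥1 (quotient-∣ d∣n)
  -- a prime q common to d and m is some pᵢ, and then I(x,pᵢd) ≤ I(x,n) = a/B
  no-common-prime : ∀ {q} → Prime q → q ∣ d → q ∣ m → ⊥
  no-common-prime {q} q-prime q∣d q∣m
    with All.lookupAny below (prime-∣-primePowProd ps q-prime primes q∣d)
  ... | a/B<I[pd] , q≡p = ℚP.<-irrefl a/B≡In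
    (ℚP.<-≤-trans a/B<I[pd] (abundancy-mono x n≥1 (subst (λ p → p * d ∣ n) q≡p qd∣n)))
    where
    qd∣n : q * d ∣ n
    qd∣n = subst (q * d ∣_) (trans (*-comm m d) (sym n≡dm)) (*-monoˡ-∣ d q∣m)
  d⊥m : Coprime d m
  d⊥m = no-common-prime⇒coprime d≥1 no-common-prime
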